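{- Let $S$ be a finite nonempty set and $p:2^S\to\mathbb{Z}\cup\{ -\infty\}$ an integer-valued supermodular function with $p(\emptyset)=0$ and $p(S)>-\infty$. Define $C_0=\emptyset$ and, for $j=1,2,\dots$ while $C_{j-1}\ne S$, with $\overline{C_{j-1}}=S\setminus C_{j-1}$: $\beta_j=\max\{\lceil (p(X\cup C_{j-1})-p(C_{j-1}))/|X|\rceil : \emptyset\ne X\subseteq\overline{C_{j-1}}\}$, $h_j(X)=p(X\cup C_{j-1})-(\beta_j-1)|X|-p(C_{j-1})$ for $X\subseteq\overline{C_{j-1}}$, $S_j$ = the smallest subset of $\overline{C_{j-1}}$ maximizing $h_j$, $C_j=C_{j-1}\cup S_j$, and let $q$ be the index with $C_{q-1}\ne S$, $C_q=S$. Then (1) $\beta_1>\beta_2>\dots>\beta_q$; (2) for each $j$ with $1\le j\le q$, $C_j$ is the smallest maximizer of $p(X)-(\beta_j-1)|X|$ among all subsets $X$ of $S$.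
   Context: Supermodular: $p(X)+p(Y)\le p(X\cap Y)+p(X\cup Y)$ whenever $p(X),p(Y)$ are finite. -}

module Defs where

open import Data.Nat as ℕ using (ℕ; zero; suc)
open import Data.Integer as ℤ using (ℤ; -_; _+_; _-_; _*_; +_; 1ℤ)
open import Data.Integer.DivMod using (_/ℕ_)
open import Data.Fin.Subset using (Subset; _⊆_; _∪_; _∩_; ∁; ∣_∣; Nonempty; ⊥; ⊤)
open import Data.Product using (Σ; _×_; ∃; _,_)
open import Relation.Binary.PropositionalEquality using (_≡_; _≢_)

data ℤ∞ : Set where
  -∞  : ℤ∞
  fin : ℤ → ℤ∞

infix 4 _≤∞_
data _≤∞_ : ℤ∞ → ℤ∞ → Set where
  -∞≤ : ∀ {x} → -∞ ≤∞ x
  fin≤ : ∀ {a b} → a ℤ.≤ b → fin a ≤∞ fin b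

infixl 6 _+∞_
_+∞_ : ℤ∞ → ℤ∞ → ℤ∞
-∞ +∞ _ = -∞
fin a +∞ -∞ = -∞
fin a +∞ fin b = fin (a + b)

infixl 6 _-ᶠ_
_-ᶠ_ : ℤ∞ → ℤ → ℤ∞
-∞ -ᶠ b = -∞
fin a -ᶠ b = fin (a - b)

-- ceiling of a / k for k ≥ 1 (value at k = 0 is junk and never used)
⌈_/_⌉ : ℤ → ℕ → ℤ
⌈ a / zero ⌉ = + 0
⌈ a / suc k ⌉ = - ((- a) /ℕ suc k)

⌈_/_⌉∞ : ℤ∞ → ℕ → ℤ∞
⌈ -∞ / k ⌉∞ = -∞
⌈ fin a / k ⌉∞ = fin ⌈ a / k ⌉

Supermodular : ∀ {n} → (Subset n → ℤ∞) → Set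
Supermodular {n} p = ∀ (X Y : Subset n) (a b : ℤ) → p X ≡ fin a → p Y ≡ fin b →
  fin (a + b) ≤∞ p (X ∩ Y) +∞ p (X ∪ Y)

IsMaximizer : ∀ {n} → (Subset n → Set) → (Subset n → ℤ∞) → Subset n → Set
IsMaximizer {n} Dom f M = Dom M × (∀ (X : Subset n) → Dom X → f X ≤∞ f M)

IsSmallestMaximizer : ∀ {n} → (Subset n → Set) → (Subset n → ℤ∞) → Subset n → Set
IsSmallestMaximizer {n} Dom f M =
  IsMaximizer Dom f M × (∀ (Y : Subset n) → IsMaximizer Dom f Y → M ⊆ Y)

IsBeta : ∀ {n} → (Subset n → ℤ∞) → Subset n → ℤ → ℤ → Set
IsBeta {n} p C c β =
  (Σ (Subset n) λ X → Nonempty X × X ⊆ ∁ C × ⌈ p (X ∪ C) -ᶠ c / ∣ X ∣ ⌉∞ ≡ fin β)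
  × (∀ (X : Subset n) → Nonempty X → X ⊆ ∁ C → ⌈ p (X ∪ C) -ᶠ c / ∣ X ∣ ⌉∞ ≤∞ fin β)

h : ∀ {n} → (Subset n → ℤ∞) → Subset n → ℤ → ℤ → Subset n → ℤ∞
h p C c β X = p (X ∪ C) -ᶠ ((β - 1ℤ) * + ∣ X ∣) -ᶠ c

record Construction {n : ℕ} (p : Subset n → ℤ∞) : Set where
  field
    q : ℕ
    C : ℕ → Subset n
    Sj : ℕ → Subset n
    β : ℕ → ℤ
    c : ℕ → ℤ      -- c j = the (finite) value p(C_j), needed for h and β to make sense
    C0 : C 0 ≡ ⊥
    Cq : C q ≡ ⊤
    pC : ∀ j → j ℕ.< q → p (C j) ≡ fin (c j)
    notDone : ∀ j → j ℕ.< q → C j ≢ ⊤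
    isβ : ∀ j → j ℕ.< q → IsBeta p (C j) (c j) (β (suc j))
    isS : ∀ j → j ℕ.< q →
      IsSmallestMaximizer (λ X → X ⊆ ∁ (C j)) (h p (C j) (c j) (β (suc j))) (Sj (suc j))
    isC : ∀ j → j ℕ.< q → C (suc j) ≡ C j ∪ Sj (suc j)

module Submission where

-- Write  pen p k X = p(X) − k·|X|.  After basic facts on finite sets, integer
-- arithmetic and the ordered set ℤ ∪ {−∞}, the file proves three general facts.
--  * (Restriction) If C is *forced* for pen p k — adding C never lowers the value
--    and every maximiser contains C — then maximising pen p k over all sets is
--    maximising X ↦ p(X ∪ C) − k|X| over X ⊆ S∖C, up to an additive constant;
--    so the smallest maximiser of h_j (with k = β_j − 1) yields C ∪ S_j as the
--    smallest maximiser of pen p k.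
--  * (Slope drop) If D maximises pen p k, then every marginal ratio
--    (p(X ∪ D) − p(D)) / |X| is at most k, so the next β is at most k = β − 1.
--  * (Supermodular forcing) If p is supermodular and C maximises pen p k′,
--    then C is forced for pen p k for every smaller slope k < k′.
-- The module Steps runs an induction along the construction: C₀ = ∅ is forced,
-- restriction makes C_j the smallest maximiser, slope drop gives β_{j+1} < β_j,
-- and supermodular forcing makes C_j forced for the next slope β_{j+1} − 1.
-- The proposition then reads both claims off Steps.

open import Defs
open import Data.Nat as ℕ using (ℕ; suc; _≤_; _<_)
open import Data.Integer as ℤ using (ℤ; _-_; _*_; +_; 1ℤ)
open import Data.Fin.Subset using (Subset; ∣_∣; ⊥; ⊤)
open import Data.Product using (Σ; _×_)
open import Relation.Binary.PropositionalEquality using (_≡_; _≢_)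

open import Data.Nat using (zero; z≤n; s≤s)
import Data.Nat.Properties as ℕP
import Data.Integer.Properties as ℤP
open import Data.Integer.DivMod using (_/ℕ_; n<s[n/ℕd]*d)
open import Data.Integer.Tactic.RingSolver using (solve-∀)
open import Data.Fin.Subset using (_⊆_; _∪_; _∩_; _─_; ∁; Nonempty; inside; outside)
open import Data.Fin.Subset.Properties
  using (drop-∷-⊆; x∈p∪q⁻; ∪-comm; ∪-identityʳ; ⊆-min)
open import Data.Vec using (_∷_; [])
open import Data.Vec.Base using (here; there)
open import Data.Product using (_,_; proj₁; proj₂)
open import Data.Sum using (inj₁; inj₂)
open import Relation.Nullary using (¬_; contradiction)
open import Relation.Binary.Bundles using (Preorder)
import Relation.Binary.Reasoning.Preorder
open import Relation.Binary.PropositionalEquality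
  using (refl; sym; trans; cong; subst; isEquivalence; module ≡-Reasoning)

∪-lub : ∀ {n} {A B Y : Subset n} → A ⊆ Y → B ⊆ Y → A ∪ B ⊆ Y
∪-lub {A = A} {B} A⊆Y B⊆Y x∈A∪B with x∈p∪q⁻ A B x∈A∪B
... | inj₁ x∈A = A⊆Y x∈A
... | inj₂ x∈B = B⊆Y x∈B

─⊆∁ : ∀ {n} (Y C : Subset n) → Y ─ C ⊆ ∁ C
─⊆∁ (y ∷ Y) (inside ∷ C) (there x∈) = there (─⊆∁ Y C x∈)
─⊆∁ (y ∷ Y) (outside ∷ C) here = here
─⊆∁ (y ∷ Y) (outside ∷ C) (there x∈) = there (─⊆∁ Y C x∈)

─⊆ : ∀ {n} (Y C : Subset n) → Y ─ C ⊆ Y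
─⊆ (y ∷ Y) (inside ∷ C) (there x∈) = there (─⊆ Y C x∈)
─⊆ (y ∷ Y) (outside ∷ C) here = here
─⊆ (y ∷ Y) (outside ∷ C) (there x∈) = there (─⊆ Y C x∈)

─∪ : ∀ {n} (Y C : Subset n) → (Y ─ C) ∪ C ≡ Y ∪ C
─∪ [] [] = refl
─∪ (inside ∷ Y) (inside ∷ C) = cong (inside ∷_) (─∪ Y C)
─∪ (inside ∷ Y) (outside ∷ C) = cong (inside ∷_) (─∪ Y C)
─∪ (outside ∷ Y) (inside ∷ C) = cong (inside ∷_) (─∪ Y C)
─∪ (outside ∷ Y) (outside ∷ C) = cong (outside ∷_) (─∪ Y C)

─∪-cancel : ∀ {n} (Y C : Subset n) → C ⊆ Y → (Y ─ C) ∪ C ≡ Y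
─∪-cancel [] [] _ = refl
─∪-cancel (inside ∷ Y) (inside ∷ C) C⊆Y = cong (inside ∷_) (─∪-cancel Y C (drop-∷-⊆ C⊆Y))
─∪-cancel (inside ∷ Y) (outside ∷ C) C⊆Y = cong (inside ∷_) (─∪-cancel Y C (drop-∷-⊆ C⊆Y))
─∪-cancel (outside ∷ Y) (outside ∷ C) C⊆Y = cong (outside ∷_) (─∪-cancel Y C (drop-∷-⊆ C⊆Y))
─∪-cancel (outside ∷ Y) (inside ∷ C) C⊆Y with C⊆Y here
... | ()

∣∪∣-disjoint : ∀ {n} (X C : Subset n) → X ⊆ ∁ C → ∣ X ∪ C ∣ ≡ ∣ X ∣ ℕ.+ ∣ C ∣
∣∪∣-disjoint [] [] _ = refl
∣∪∣-disjoint (outside ∷ X) (outside ∷ C) X⊆ = ∣∪∣-disjoint X C (drop-∷-⊆ X⊆)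
∣∪∣-disjoint (outside ∷ X) (inside ∷ C) X⊆ =
  trans (cong suc (∣∪∣-disjoint X C (drop-∷-⊆ X⊆))) (sym (ℕP.+-suc ∣ X ∣ ∣ C ∣))
∣∪∣-disjoint (inside ∷ X) (outside ∷ C) X⊆ = cong suc (∣∪∣-disjoint X C (drop-∷-⊆ X⊆))
∣∪∣-disjoint (inside ∷ X) (inside ∷ C) X⊆ with X⊆ here
... | ()

∣∪∣≡∣∣+∣─∣ : ∀ {n} (Y C : Subset n) → ∣ Y ∪ C ∣ ≡ ∣ Y ∣ ℕ.+ ∣ C ─ Y ∣
∣∪∣≡∣∣+∣─∣ [] [] = refl
∣∪∣≡∣∣+∣─∣ (inside ∷ Y) (c ∷ C) = cong suc (∣∪∣≡∣∣+∣─∣ Y C)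
∣∪∣≡∣∣+∣─∣ (outside ∷ Y) (inside ∷ C) =
  trans (cong suc (∣∪∣≡∣∣+∣─∣ Y C)) (sym (ℕP.+-suc ∣ Y ∣ ∣ C ─ Y ∣))
∣∪∣≡∣∣+∣─∣ (outside ∷ Y) (outside ∷ C) = ∣∪∣≡∣∣+∣─∣ Y C

∣∣≡∣∩∣+∣─∣ : ∀ {n} (Y C : Subset n) → ∣ C ∣ ≡ ∣ Y ∩ C ∣ ℕ.+ ∣ C ─ Y ∣
∣∣≡∣∩∣+∣─∣ [] [] = refl
∣∣≡∣∩∣+∣─∣ (inside ∷ Y) (inside ∷ C) = cong suc (∣∣≡∣∩∣+∣─∣ Y C)
∣∣≡∣∩∣+∣─∣ (inside ∷ Y) (outside ∷ C) = ∣∣≡∣∩∣+∣─∣ Y C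
∣∣≡∣∩∣+∣─∣ (outside ∷ Y) (inside ∷ C) =
  trans (cong suc (∣∣≡∣∩∣+∣─∣ Y C)) (sym (ℕP.+-suc ∣ Y ∩ C ∣ ∣ C ─ Y ∣))
∣∣≡∣∩∣+∣─∣ (outside ∷ Y) (outside ∷ C) = ∣∣≡∣∩∣+∣─∣ Y C

∣─∣≡0⇒⊆ : ∀ {n} (C Y : Subset n) → ∣ C ─ Y ∣ ≡ 0 → C ⊆ Y
∣─∣≡0⇒⊆ (inside ∷ C) (inside ∷ Y) e here = here
∣─∣≡0⇒⊆ (c ∷ C) (inside ∷ Y) e (there x∈) = there (∣─∣≡0⇒⊆ C Y e x∈)
∣─∣≡0⇒⊆ (outside ∷ C) (outside ∷ Y) e (there x∈) = there (∣─∣≡0⇒⊆ C Y e x∈)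
∣─∣≡0⇒⊆ (inside ∷ C) (outside ∷ Y) () _

Nonempty⇒1≤∣∣ : ∀ {n} {X : Subset n} → Nonempty X → 1 ≤ ∣ X ∣
Nonempty⇒1≤∣∣ {X = inside ∷ X} _ = s≤s z≤n
Nonempty⇒1≤∣∣ {X = outside ∷ X} (_ , there x∈) = Nonempty⇒1≤∣∣ (_ , x∈)

≤-by-difference : ∀ {a b x y : ℤ} → x ℤ.≤ y → b - a ≡ y - x → a ℤ.≤ b
≤-by-difference x≤y eq =
  ℤP.0≤i-j⇒j≤i (subst (ℤ.0ℤ ℤ.≤_) (sym eq) (ℤP.i≤j⇒0≤j-i x≤y))

gain⇒penalised≤ : ∀ y v k M d → k * d ℤ.≤ v - y → y - k * M ℤ.≤ v - k * (M ℤ.+ d)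
gain⇒penalised≤ y v k M d kd≤ = ≤-by-difference kd≤ (eq y v k M d)
  where
  eq : ∀ y v k M d → (v - k * (M ℤ.+ d)) - (y - k * M) ≡ (v - y) - k * d
  eq = solve-∀

penalised≤⇒gain : ∀ y v k M d → v - k * (M ℤ.+ d) ℤ.≤ y - k * M → v - y ℤ.≤ k * d
penalised≤⇒gain y v k M d ≤pen = ≤-by-difference ≤pen (eq y v k M d)
  where
  eq : ∀ y v k M d → k * d - (v - y) ≡ (y - k * M) - (v - k * (M ℤ.+ d))
  eq = solve-∀

slope-gap : ∀ {k k′ : ℤ} (d : ℕ) → k ℤ.< k′ → k′ * + d ℤ.≤ k * + d → d ≡ 0
slope-gap zero _ _ = refl
slope-gap (suc d) k<k′ k′d≤kd = contradiction (ℤP.*-monoʳ-<-pos (+ suc d) k<k′) (ℤP.≤⇒≯ k′d≤kd)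

⌈/⌉-least : ∀ (a m : ℤ) (j : ℕ) → 1 ≤ j → a ℤ.≤ m * + j → ⌈ a / j ⌉ ℤ.≤ m
⌈/⌉-least a m (suc j) _ a≤mj =
  subst (ℤ.- Q ℤ.≤_) (ℤP.neg-involutive m) (ℤP.neg-mono-≤ -m≤Q)
  where
  Q : ℤ
  Q = (ℤ.- a) /ℕ suc j
  -mj≤-a : (ℤ.- m) * + suc j ℤ.≤ ℤ.- a
  -mj≤-a = subst (ℤ._≤ ℤ.- a) (ℤP.neg-distribˡ-* m (+ suc j)) (ℤP.neg-mono-≤ a≤mj)
  -m≤Q : ℤ.- m ℤ.≤ Q
  -m≤Q = ℤP.≮⇒≥ λ Q<-m → ℤP.<-irrefl refl
    (ℤP.<-≤-trans (n<s[n/ℕd]*d (ℤ.- a) (suc j))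
      (ℤP.≤-trans (ℤP.*-monoʳ-≤-nonNeg (+ suc j) (ℤP.i<j⇒suc[i]≤j Q<-m)) -mj≤-a))

≤-1⇒< : ∀ {β′ β : ℤ} → β′ ℤ.≤ β - 1ℤ → β′ ℤ.< β
≤-1⇒< {β′} {β} h = ℤP.i≤pred[j]⇒i<j (subst (β′ ℤ.≤_) (ℤP.+-comm β (ℤ.- 1ℤ)) h)

≤∞-refl : ∀ {x} → x ≤∞ x
≤∞-refl { -∞} = -∞≤
≤∞-refl {fin a} = fin≤ ℤP.≤-refl

≤∞-trans : ∀ {x y z} → x ≤∞ y → y ≤∞ z → x ≤∞ z
≤∞-trans -∞≤ _ = -∞≤
≤∞-trans (fin≤ a≤b) (fin≤ b≤c) = fin≤ (ℤP.≤-trans a≤b b≤c)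

≤∞-preorder : Preorder _ _ _
≤∞-preorder = record
  { Carrier = ℤ∞
  ; _≈_ = _≡_
  ; _≲_ = _≤∞_
  ; isPreorder = record
    { isEquivalence = isEquivalence
    ; reflexive = λ { refl → ≤∞-refl }
    ; trans = ≤∞-trans
    }
  }

-ᶠ-mono : ∀ {x y} (t : ℤ) → x ≤∞ y → x -ᶠ t ≤∞ y -ᶠ t
-ᶠ-mono t -∞≤ = -∞≤
-ᶠ-mono t (fin≤ a≤b) = fin≤ (ℤP.+-monoˡ-≤ (ℤ.- t) a≤b)

-ᶠ-cancel : ∀ {x y} (t : ℤ) → x -ᶠ t ≤∞ y -ᶠ t → x ≤∞ y
-ᶠ-cancel { -∞} t _ = -∞≤
-ᶠ-cancel {fin a} {fin b} t (fin≤ h) = fin≤ (≤-by-difference h (eq a b t))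
  where
  eq : ∀ a b t → b - a ≡ (b - t) - (a - t)
  eq = solve-∀

-ᶠ-merge : ∀ (x : ℤ∞) (a b : ℤ) → x -ᶠ a -ᶠ b ≡ x -ᶠ (a ℤ.+ b)
-ᶠ-merge -∞ a b = refl
-ᶠ-merge (fin x) a b = cong fin (eq x a b)
  where
  eq : ∀ x a b → x - a - b ≡ x - (a ℤ.+ b)
  eq = solve-∀

fin≰-∞ : ∀ {a} → ¬ (fin a ≤∞ -∞)
fin≰-∞ ()

≤∞⇒≤ : ∀ {x y a b} → x ≡ fin a → y ≡ fin b → x ≤∞ y → a ℤ.≤ b
≤∞⇒≤ refl refl (fin≤ a≤b) = a≤b

≤⇒≤∞ : ∀ {x y a b} → x ≡ fin a → y ≡ fin b → a ℤ.≤ b → x ≤∞ y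
≤⇒≤∞ refl refl a≤b = fin≤ a≤b

pen : ∀ {n} → (Subset n → ℤ∞) → ℤ → Subset n → ℤ∞
pen p k X = p X -ᶠ (k * + ∣ X ∣)

Everywhere : ∀ {n} → Subset n → Set
Everywhere {n} _ = Subset n

pen-fin : ∀ {n} (p : Subset n → ℤ∞) {X x} (k : ℤ) → p X ≡ fin x → pen p k X ≡ fin (x - k * + ∣ X ∣)
pen-fin p {X} k pX = cong (_-ᶠ (k * + ∣ X ∣)) pX

h-as-pen : ∀ {n} (p : Subset n → ℤ∞) (C : Subset n) (c β : ℤ) (Z : Subset n) → Z ⊆ ∁ C
         → h p C c β Z -ᶠ ((β - 1ℤ) * + ∣ C ∣ - c) ≡ pen p (β - 1ℤ) (Z ∪ C)
h-as-pen p C c β Z Z⊆∁C = begin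
  p (Z ∪ C) -ᶠ (k * + ∣ Z ∣) -ᶠ c -ᶠ (k * + ∣ C ∣ - c)
    ≡⟨ cong (_-ᶠ (k * + ∣ C ∣ - c)) (-ᶠ-merge (p (Z ∪ C)) _ c) ⟩
  p (Z ∪ C) -ᶠ (k * + ∣ Z ∣ ℤ.+ c) -ᶠ (k * + ∣ C ∣ - c)
    ≡⟨ -ᶠ-merge (p (Z ∪ C)) _ _ ⟩
  p (Z ∪ C) -ᶠ (k * + ∣ Z ∣ ℤ.+ c ℤ.+ (k * + ∣ C ∣ - c))
    ≡⟨ cong (p (Z ∪ C) -ᶠ_) (eq k (+ ∣ Z ∣) (+ ∣ C ∣) c) ⟩
  p (Z ∪ C) -ᶠ (k * (+ ∣ Z ∣ ℤ.+ + ∣ C ∣))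
    ≡⟨ cong (λ m → p (Z ∪ C) -ᶠ (k * m)) (sym (ℤP.pos-+ ∣ Z ∣ ∣ C ∣)) ⟩
  p (Z ∪ C) -ᶠ (k * + (∣ Z ∣ ℕ.+ ∣ C ∣))
    ≡⟨ cong (λ m → p (Z ∪ C) -ᶠ (k * + m)) (sym (∣∪∣-disjoint Z C Z⊆∁C)) ⟩
  pen p k (Z ∪ C) ∎
  where
  open ≡-Reasoning
  k : ℤ
  k = β - 1ℤ
  eq : ∀ k z m c → k * z ℤ.+ c ℤ.+ (k * m - c) ≡ k * (z ℤ.+ m)
  eq = solve-∀

Forced : ∀ {n} → (Subset n → ℤ∞) → ℤ → Subset n → Set
Forced {n} p k C = (∀ Y → pen p k Y ≤∞ pen p k (Y ∪ C))
                 × (∀ Y → IsMaximizer Everywhere (pen p k) Y → C ⊆ Y)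

∅-forced : ∀ {n} (p : Subset n → ℤ∞) (k : ℤ) → Forced p k ⊥
∅-forced p k = (λ Y → subst (pen p k Y ≤∞_) (cong (pen p k) (sym (∪-identityʳ Y))) ≤∞-refl)
             , (λ Y _ → ⊆-min Y)

forced-smallest-maximizer : ∀ {n} {p : Subset n → ℤ∞} {C S : Subset n} {c β : ℤ}
  → Forced p (β - 1ℤ) C
  → IsSmallestMaximizer (λ X → X ⊆ ∁ C) (h p C c β) S
  → IsSmallestMaximizer Everywhere (pen p (β - 1ℤ)) (C ∪ S)
forced-smallest-maximizer {p = p} {C} {S} {c} {β} (absorbs , contains) ((S⊆∁C , S-top) , S-least) =
  (C ∪ S , maximal) , least
  where
  open Relation.Binary.Reasoning.Preorder ≤∞-preorder
  k : ℤ
  k = β - 1ℤ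
  t : ℤ
  t = k * + ∣ C ∣ - c
  shift : ∀ Z → Z ⊆ ∁ C → h p C c β Z -ᶠ t ≡ pen p k (Z ∪ C)
  shift = h-as-pen p C c β
  maximal : ∀ Y → Everywhere Y → pen p k Y ≤∞ pen p k (C ∪ S)
  maximal Y _ = begin
    pen p k Y                 ≲⟨ absorbs Y ⟩
    pen p k (Y ∪ C)           ≡⟨ cong (pen p k) (sym (─∪ Y C)) ⟩
    pen p k ((Y ─ C) ∪ C)     ≡⟨ sym (shift (Y ─ C) (─⊆∁ Y C)) ⟩
    h p C c β (Y ─ C) -ᶠ t    ≲⟨ -ᶠ-mono t (S-top (Y ─ C) (─⊆∁ Y C)) ⟩
    h p C c β S -ᶠ t          ≡⟨ shift S S⊆∁C ⟩
    pen p k (S ∪ C)           ≡⟨ cong (pen p k) (∪-comm S C) ⟩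
    pen p k (C ∪ S)           ∎
  -- A maximiser Y contains C, and its part Y ∖ C maximises h, hence contains S.
  least : ∀ Y → IsMaximizer Everywhere (pen p k) Y → C ∪ S ⊆ Y
  least Y Y-max = ∪-lub C⊆Y (λ x∈S → ─⊆ Y C (S-least (Y ─ C) (─⊆∁ Y C , rest-top) x∈S))
    where
    C⊆Y : C ⊆ Y
    C⊆Y = contains Y Y-max
    rest-top : ∀ W → W ⊆ ∁ C → h p C c β W ≤∞ h p C c β (Y ─ C)
    rest-top W W⊆∁C = -ᶠ-cancel t (begin
      h p C c β W -ᶠ t          ≡⟨ shift W W⊆∁C ⟩
      pen p k (W ∪ C)           ≲⟨ proj₂ Y-max (W ∪ C) (W ∪ C) ⟩
      pen p k Y                 ≡⟨ cong (pen p k) (sym (─∪-cancel Y C C⊆Y)) ⟩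
      pen p k ((Y ─ C) ∪ C)     ≡⟨ sym (shift (Y ─ C) (─⊆∁ Y C)) ⟩
      h p C c β (Y ─ C) -ᶠ t    ∎)

marginal-ratio≤slope : ∀ {n} {p : Subset n → ℤ∞} {D X : Subset n} {k d : ℤ}
  → IsMaximizer Everywhere (pen p k) D → p D ≡ fin d → X ⊆ ∁ D → Nonempty X
  → ⌈ p (X ∪ D) -ᶠ d / ∣ X ∣ ⌉∞ ≤∞ fin k
marginal-ratio≤slope {p = p} {D} {X} {k} {d} (_ , D-top) pD X⊆∁D X≠∅ with p (X ∪ D) in pX∪D
... | -∞ = -∞≤
... | fin a = fin≤ (⌈/⌉-least (a - d) k ∣ X ∣ (Nonempty⇒1≤∣∣ X≠∅)
                      (penalised≤⇒gain d a k (+ ∣ D ∣) (+ ∣ X ∣) X∪D≤D))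
  where
  size : + ∣ X ∪ D ∣ ≡ + ∣ D ∣ ℤ.+ + ∣ X ∣
  size = trans (cong +_ (trans (∣∪∣-disjoint X D X⊆∁D) (ℕP.+-comm ∣ X ∣ ∣ D ∣))) (ℤP.pos-+ ∣ D ∣ ∣ X ∣)
  X∪D≤D : a - k * (+ ∣ D ∣ ℤ.+ + ∣ X ∣) ℤ.≤ d - k * + ∣ D ∣
  X∪D≤D = subst (λ m → a - k * m ℤ.≤ d - k * + ∣ D ∣) size
            (≤∞⇒≤ (pen-fin p k pX∪D) (pen-fin p k pD) (D-top (X ∪ D) (X ∪ D)))

slope-drops : ∀ {n} {p : Subset n → ℤ∞} {D : Subset n} {d β β′ : ℤ}
  → IsMaximizer Everywhere (pen p (β - 1ℤ)) D → p D ≡ fin d → IsBeta p D d β′ → β′ ℤ.< β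
slope-drops D-max pD ((X , X≠∅ , X⊆∁D , ratio≡β′) , _) =
  ≤-1⇒< (≤∞⇒≤ ratio≡β′ refl (marginal-ratio≤slope D-max pD X⊆∁D X≠∅))

module _ {n : ℕ} {p : Subset n → ℤ∞} (supermodular : Supermodular p)
         {k′ c : ℤ} {C : Subset n} (C-max : IsMaximizer Everywhere (pen p k′) C) (pC : p C ≡ fin c)
         where

  supermodular-gain : ∀ {Y y} → p Y ≡ fin y
    → Σ ℤ λ v → p (Y ∪ C) ≡ fin v × k′ * + ∣ C ─ Y ∣ ℤ.≤ v - y
  supermodular-gain {Y} {y} pY with p (Y ∩ C) in pY∩C | p (Y ∪ C) in pY∪C | supermodular Y C y c pY pC
  ... | fin u | fin v | fin≤ y+c≤u+v =
    v , refl , ≤-by-difference (ℤP.+-mono-≤ y+c≤u+v Y∩C≤C) (eq y c u v k′ (+ ∣ Y ∩ C ∣) (+ ∣ C ─ Y ∣))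
    where
    size : + ∣ C ∣ ≡ + ∣ Y ∩ C ∣ ℤ.+ + ∣ C ─ Y ∣
    size = trans (cong +_ (∣∣≡∣∩∣+∣─∣ Y C)) (ℤP.pos-+ ∣ Y ∩ C ∣ ∣ C ─ Y ∣)
    Y∩C≤C : u - k′ * + ∣ Y ∩ C ∣ ℤ.≤ c - k′ * (+ ∣ Y ∩ C ∣ ℤ.+ + ∣ C ─ Y ∣)
    Y∩C≤C = subst (λ m → u - k′ * + ∣ Y ∩ C ∣ ℤ.≤ c - k′ * m) size
              (≤∞⇒≤ (pen-fin p k′ pY∩C) (pen-fin p k′ pC) (proj₂ C-max (Y ∩ C) (Y ∩ C)))
    eq : ∀ y c u v k I d → (v - y) - k * d ≡ (u ℤ.+ v ℤ.+ (c - k * (I ℤ.+ d))) - (y ℤ.+ c ℤ.+ (u - k * I))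
    eq = solve-∀

  maximizer-forced : ∀ {k} → k ℤ.< k′ → Forced p k C
  maximizer-forced {k} k<k′ = absorbs , contains
    where
    size : ∀ Y → + ∣ Y ∪ C ∣ ≡ + ∣ Y ∣ ℤ.+ + ∣ C ─ Y ∣
    size Y = trans (cong +_ (∣∪∣≡∣∣+∣─∣ Y C)) (ℤP.pos-+ ∣ Y ∣ ∣ C ─ Y ∣)
    absorbs : ∀ Y → pen p k Y ≤∞ pen p k (Y ∪ C)
    -- Matching on p(Y) also exposes its value inside the goal (and below in Y-top).
    absorbs Y with p Y in pY
    ... | -∞ = -∞≤
    ... | fin y with supermodular-gain pY
    ...   | v , pY∪C , gain = ≤⇒≤∞ refl (pen-fin p k pY∪C)
        (subst (λ m → y - k * + ∣ Y ∣ ℤ.≤ v - k * m) (sym (size Y))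
          (gain⇒penalised≤ y v k (+ ∣ Y ∣) (+ ∣ C ─ Y ∣)
            (ℤP.≤-trans (ℤP.*-monoʳ-≤-nonNeg (+ ∣ C ─ Y ∣) (ℤP.<⇒≤ k<k′)) gain)))
    -- A maximiser Y gains nothing from C, which at slope k′ > k is only
    -- possible when C ∖ Y is empty.
    contains : ∀ Y → IsMaximizer Everywhere (pen p k) Y → C ⊆ Y
    contains Y (_ , Y-top) with p Y in pY
    ... | -∞ = contradiction (subst (_≤∞ -∞) (pen-fin p k pC) (Y-top C C)) fin≰-∞
    ... | fin y with supermodular-gain pY
    ...   | v , pY∪C , gain = ∣─∣≡0⇒⊆ C Y (slope-gap ∣ C ─ Y ∣ k<k′ (ℤP.≤-trans gain no-gain))
      where
      no-gain : v - y ℤ.≤ k * + ∣ C ─ Y ∣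
      no-gain = penalised≤⇒gain y v k (+ ∣ Y ∣) (+ ∣ C ─ Y ∣)
        (subst (λ m → v - k * m ℤ.≤ y - k * + ∣ Y ∣) (size Y)
          (≤∞⇒≤ (pen-fin p k pY∪C) refl (Y-top (Y ∪ C) (Y ∪ C))))

module Steps {n : ℕ} {p : Subset n → ℤ∞} (supermodular : Supermodular p) (K : Construction p) where
  open Construction K

  step-smallest : ∀ i → i < q → Forced p (β (suc i) - 1ℤ) (C i)
    → IsSmallestMaximizer Everywhere (pen p (β (suc i) - 1ℤ)) (C (suc i))
  step-smallest i i<q C-forced =
    subst (IsSmallestMaximizer Everywhere (pen p (β (suc i) - 1ℤ))) (sym (isC i i<q))
      (forced-smallest-maximizer {β = β (suc i)} C-forced (isS i i<q))

  step-drops : ∀ i → suc i < q → IsMaximizer Everywhere (pen p (β (suc i) - 1ℤ)) (C (suc i))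
    → β (suc (suc i)) ℤ.< β (suc i)
  step-drops i si<q C-max = slope-drops C-max (pC (suc i) si<q) (isβ (suc i) si<q)

  forced : ∀ i → i < q → Forced p (β (suc i) - 1ℤ) (C i)
  forced zero _ = subst (Forced p (β 1 - 1ℤ)) (sym C0) (∅-forced p (β 1 - 1ℤ))
  forced (suc i) si<q =
    maximizer-forced supermodular C-max (pC (suc i) si<q)
      (ℤP.+-monoˡ-< (ℤ.- 1ℤ) (step-drops i si<q C-max))
    where
    C-max : IsMaximizer Everywhere (pen p (β (suc i) - 1ℤ)) (C (suc i))
    C-max = proj₁ (step-smallest i (ℕP.<⇒≤ si<q) (forced i (ℕP.<⇒≤ si<q)))

  -- Claim (2) at step i+1 and claim (1) at step i+2.
  smallest : ∀ i → i < q → IsSmallestMaximizer Everywhere (pen p (β (suc i) - 1ℤ)) (C (suc i))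
  smallest i i<q = step-smallest i i<q (forced i i<q)

  decreasing : ∀ i → suc i < q → β (suc (suc i)) ℤ.< β (suc i)
  decreasing i si<q = step-drops i si<q (proj₁ (smallest i (ℕP.<⇒≤ si<q)))

proposition6p4 : ∀ (n : ℕ) → 1 ≤ n → (p : Subset n → ℤ∞) → Supermodular p
    → p ⊥ ≡ fin (+ 0) → p ⊤ ≢ -∞ → (K : Construction p)
    → (∀ j → 1 ≤ j → suc j ≤ Construction.q K → Construction.β K (suc j) ℤ.< Construction.β K j)
      × (∀ j → 1 ≤ j → j ≤ Construction.q K →
          IsSmallestMaximizer (λ X → Subset n) (λ X → p X -ᶠ ((Construction.β K j - 1ℤ) * + ∣ X ∣)) (Construction.C K j))
proposition6p4 n _ p supermodular _ _ K = slopes-decrease , smallest-maximizers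
  where
  open Construction K using (q; β; C)
  open Steps supermodular K
  slopes-decrease : ∀ j → 1 ≤ j → suc j ≤ q → β (suc j) ℤ.< β j
  slopes-decrease (suc i) _ si<q = decreasing i si<q
  smallest-maximizers : ∀ j → 1 ≤ j → j ≤ q → IsSmallestMaximizer Everywhere (pen p (β j - 1ℤ)) (C j)
  smallest-maximizers (suc i) _ i<q = smallest i i<q
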